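{- Let $\mathcal{G}$ be a finite simple undirected connected graph. If $H_1$ and $H_2$ are F-twin induced subgraphs of $\mathcal{G}$ with disjoint vertex sets, then $H_1$ and $H_2$ are homometric, i.e., the multiset of distances in $\mathcal{G}$ between pairs of distinct vertices of $H_1$ equals the corresponding multiset for $H_2$.
   Context: All graphs are finite, undirected, without loops or parallel edges. For a vertex $u$, $\mathcal{N}(u)$ denotes the set of vertices adjacent to $u$. Two induced subgraphs $H_1,H_2$ of $\mathcal{G}$ with vertex sets $V_1,V_2$ are called F-twins if there is a graph isomorphism $\varphi:V_1\to V_2$ between $H_1$ and $H_2$ such that $\mathcal{N}(u)-V_1=\mathcal{N}(\varphi(u))-V_2$ for all $u\in V_1$. The distance multiset of an order-$k$ subgraph $H$ of a connected graph $\mathcal{G}$ is the multiset of the $\binom{k}{2}$ distances (measured in $\mathcal{G}$) between pairs of vertices of $H$. -}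

module Defs where

open import Data.Nat using (ℕ; zero; suc; _≤_; _<ᵇ_)
open import Data.Bool using (Bool; true; false; if_then_else_; _∧_)
open import Data.Fin using (Fin; toℕ)
open import Data.Fin.Subset using (Subset; _∈_; _∉_)
open import Data.Fin.Subset.Properties using (_∈?_)
open import Data.List using (List; []; _∷_; concatMap; allFin)
open import Data.Product using (Σ; _×_; ∃)
open import Data.Empty using (⊥)
open import Relation.Nullary using (does)
open import Relation.Binary.PropositionalEquality using (_≡_)
open import Function.Bundles using (_⇔_)

record Graph (n : ℕ) : Set where
  field
    adj   : Fin n → Fin n → Bool
    sym   : ∀ u v → adj u v ≡ adj v u
    irrefl : ∀ u → adj u u ≡ false
open Graph public

Adj : ∀ {n} → Graph n → Fin n → Fin n → Set
Adj G u v = adj G u v ≡ true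

data Walk {n : ℕ} (G : Graph n) : Fin n → Fin n → ℕ → Set where
  here : ∀ {u} → Walk G u u zero
  step : ∀ {u w v ℓ} → Adj G u w → Walk G w v ℓ → Walk G u v (suc ℓ)

Connected : ∀ {n} → Graph n → Set
Connected G = ∀ u v → ∃ λ ℓ → Walk G u v ℓ

IsDist : ∀ {n} → Graph n → Fin n → Fin n → ℕ → Set
IsDist G u v d = Walk G u v d × (∀ m → Walk G u v m → d ≤ m)

IsDistFun : ∀ {n} → Graph n → (Fin n → Fin n → ℕ) → Set
IsDistFun G dist = ∀ u v → IsDist G u v (dist u v)

-- Distance multiset (as a list, compared up to permutation) of the induced
-- subgraph with vertex set V: the distances dist u v over all unordered pairs
-- {u , v} of distinct vertices of V (each pair listed once, as toℕ u < toℕ v).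
distMultiset : ∀ {n} → (Fin n → Fin n → ℕ) → Subset n → List ℕ
distMultiset {n} dist V =
  concatMap (λ u → concatMap (λ v →
      if does (u ∈? V) ∧ does (v ∈? V) ∧ (toℕ u <ᵇ toℕ v)
      then dist u v ∷ [] else []) (allFin n)) (allFin n)

Disjoint : ∀ {n} → Subset n → Subset n → Set
Disjoint V₁ V₂ = ∀ u → u ∈ V₁ → u ∈ V₂ → ⊥

-- φ (given as a map on Fin n, only its restriction to V₁ matters) is a graph
-- isomorphism from the induced subgraph G[V₁] onto G[V₂].
IsInducedIso : ∀ {n} → Graph n → Subset n → Subset n → (Fin n → Fin n) → Set
IsInducedIso G V₁ V₂ φ =
  (∀ u → u ∈ V₁ → φ u ∈ V₂) ×
  (∀ u v → u ∈ V₁ → v ∈ V₁ → φ u ≡ φ v → u ≡ v) ×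
  (∀ w → w ∈ V₂ → ∃ λ u → u ∈ V₁ × φ u ≡ w) ×
  (∀ u v → u ∈ V₁ → v ∈ V₁ → adj G u v ≡ adj G (φ u) (φ v))

-- F-twins: an isomorphism φ with N(u) − V₁ = N(φ u) − V₂ for all u ∈ V₁.
FTwins : ∀ {n} → Graph n → Subset n → Subset n → Set
FTwins {n} G V₁ V₂ = Σ (Fin n → Fin n) λ φ → IsInducedIso G V₁ V₂ φ ×
  (∀ u → u ∈ V₁ → ∀ w → ((Adj G u w × w ∉ V₁) ⇔ (Adj G (φ u) w × w ∉ V₂)))

-- Extend the F-twin isomorphism φ : V₁ → V₂ to an involution ψ of the whole
-- vertex set: ψ = φ on V₁, φ⁻¹ on V₂ and the identity elsewhere.  Because the
-- twins are disjoint, the twin condition forbids edges between V₁ and V₂ and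
-- makes every outside neighbour of u a neighbour of φ u and vice versa, so ψ is
-- a graph automorphism and hence preserves distances.  Since ψ maps V₁ onto V₂,
-- it matches the ordered pairs of distinct vertices of V₁ with those of V₂ at
-- the same distance; each unordered pair is counted twice among ordered pairs,
-- so the two distance multisets have the same multiplicities.
module Submission where

open import Defs hiding (sym)
open import Algebra.Bundles using (CommutativeMonoid)
open import Algebra.Properties.CommutativeSemigroup using (x∙yz≈y∙xz)
open import Data.Bool using (Bool; true; false; if_then_else_; _∧_; not)
open import Data.Bool.Properties using (∧-zeroʳ; ∧-commutativeMonoid)
open import Data.Empty using (⊥-elim)
open import Data.Fin as Fin using (Fin; toℕ; _≟_)
open import Data.Fin.Permutation using (permutation)
open import Data.Fin.Properties using (toℕ-injective)
open import Data.Fin.Subset using (Subset; _∈_; _∉_)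
open import Data.Fin.Subset.Properties using (_∈?_)
open import Data.List using (List; []; _∷_; _++_; concatMap; tabulate; allFin)
open import Data.List.Membership.Propositional using () renaming (_∈_ to _∈ˡ_)
open import Data.List.Membership.Propositional.Properties using (∈-∃++)
open import Data.List.Relation.Binary.Permutation.Propositional using (_↭_; ↭-refl; prep; ↭-trans; ↭-sym)
open import Data.List.Relation.Binary.Permutation.Propositional.Properties using (shift)
open import Data.List.Relation.Unary.Any using (here; there)
open import Data.Nat using (ℕ; zero; suc; _+_; _*_; _≤_; _<_; _<ᵇ_; z<s)
open import Data.Nat.Properties as ℕ using (+-0-commutativeMonoid; +-commutativeSemigroup; +-identityʳ; +-assoc; +-cancelˡ-≡; *-cancelˡ-≡; ≤-antisym; <-cmp; <⇒<ᵇ)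
open import Data.Product using (_×_; _,_; proj₁; proj₂; ∃)
open import Function.Base using (_∘_; id)
open import Function.Bundles using (_⇔_; mk⇔; Equivalence)
open import Relation.Binary.Definitions using (tri<; tri≈; tri>)
open import Relation.Binary.PropositionalEquality using (_≡_; refl; sym; trans; cong; cong₂; subst; module ≡-Reasoning)
open import Relation.Nullary using (¬_; does; yes; no; contradiction)
open import Relation.Nullary.Decidable using (dec-true; dec-false; does-⇔; T?)

open import Algebra.Properties.CommutativeMonoid.Sum +-0-commutativeMonoid using (sum; sum-syntax; ∑-distrib-+; ∑-comm; sum-permute; sum-cong-≗)

𝟙 : Bool → ℕ
𝟙 b = if b then 1 else 0

𝟙[_≡_] : ℕ → ℕ → ℕ
𝟙[ x ≡ k ] = 𝟙 (does (x ℕ.≟ k))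

count : ℕ → List ℕ → ℕ
count k []       = 0
count k (x ∷ xs) = 𝟙[ x ≡ k ] + count k xs

count-++ : ∀ k xs ys → count k (xs ++ ys) ≡ count k xs + count k ys
count-++ k []       ys = refl
count-++ k (x ∷ xs) ys =
  trans (cong (𝟙[ x ≡ k ] +_) (count-++ k xs ys)) (sym (+-assoc 𝟙[ x ≡ k ] (count k xs) (count k ys)))

count-shift : ∀ k x xs ys → count k (xs ++ x ∷ ys) ≡ count k (x ∷ xs ++ ys)
count-shift k x xs ys = begin
  count k (xs ++ x ∷ ys)                    ≡⟨ count-++ k xs (x ∷ ys) ⟩
  count k xs + (𝟙[ x ≡ k ] + count k ys)    ≡⟨ x∙yz≈y∙xz +-commutativeSemigroup (count k xs) 𝟙[ x ≡ k ] (count k ys) ⟩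
  𝟙[ x ≡ k ] + (count k xs + count k ys)    ≡⟨ cong (𝟙[ x ≡ k ] +_) (count-++ k xs ys) ⟨
  count k (x ∷ xs ++ ys)                    ∎
  where open ≡-Reasoning

count-∷-self : ∀ x xs → count x (x ∷ xs) ≡ suc (count x xs)
count-∷-self x xs rewrite dec-true (x ℕ.≟ x) refl = refl

count-if-singleton : ∀ k c x → count k (if c then x ∷ [] else []) ≡ 𝟙 (c ∧ does (x ℕ.≟ k))
count-if-singleton k true  x = +-identityʳ 𝟙[ x ≡ k ]
count-if-singleton k false x = refl

count>0⇒∈ : ∀ k xs → 0 < count k xs → k ∈ˡ xs
count>0⇒∈ k (x ∷ xs) pos with x ℕ.≟ k
... | yes refl = here refl
... | no x≢k   =
  there (count>0⇒∈ k xs (subst (λ b → 0 < 𝟙 b + count k xs) (dec-false (x ℕ.≟ k) x≢k) pos))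

count-≗⇒↭ : ∀ xs ys → (∀ k → count k xs ≡ count k ys) → xs ↭ ys
count-≗⇒↭ []       []       _  = ↭-refl
count-≗⇒↭ []       (y ∷ ys) eq = contradiction (trans (eq y) (count-∷-self y ys)) λ ()
count-≗⇒↭ (x ∷ xs) ys       eq
  with ∈-∃++ (count>0⇒∈ x ys (subst (0 <_) (trans (sym (count-∷-self x xs)) (eq x)) z<s))
... | as , bs , refl = ↭-trans (prep x (count-≗⇒↭ xs (as ++ bs) eq′)) (↭-sym (shift x as bs))
  where
  eq′ : ∀ k → count k xs ≡ count k (as ++ bs)
  eq′ k = +-cancelˡ-≡ 𝟙[ x ≡ k ] _ _ (trans (eq k) (count-shift k x as bs))

count-concatMap : ∀ k {n} {A : Set} (f : A → List ℕ) (g : Fin n → A) →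
                  count k (concatMap f (tabulate g)) ≡ ∑[ i < n ] count k (f (g i))
count-concatMap k {zero}  f g = refl
count-concatMap k {suc n} f g =
  trans (count-++ k (f (g Fin.zero)) _) (cong (count k (f (g Fin.zero)) +_) (count-concatMap k f (g ∘ Fin.suc)))

distinct : ∀ {n} → Fin n → Fin n → Bool
distinct u v = not (does (u ≟ v))

ascending : ∀ {n} → Fin n → Fin n → Bool
ascending u v = toℕ u <ᵇ toℕ v

𝟙-distinct-split : ∀ {n} (u v : Fin n) b →
                   𝟙 (distinct u v ∧ b) ≡ 𝟙 (ascending u v ∧ b) + 𝟙 (ascending v u ∧ b)
𝟙-distinct-split u v b with <-cmp (toℕ u) (toℕ v)
... | tri< u<v u≢v _
  rewrite dec-false (u ≟ v) (u≢v ∘ cong toℕ) | dec-true (T? (ascending u v)) (<⇒<ᵇ u<v)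
        | dec-false (T? (ascending v u)) (ℕ.<⇒≯ u<v ∘ ℕ.<ᵇ⇒< _ _) = sym (+-identityʳ _)
... | tri> _ u≢v v<u
  rewrite dec-false (u ≟ v) (u≢v ∘ cong toℕ) | dec-true (T? (ascending v u)) (<⇒<ᵇ v<u)
        | dec-false (T? (ascending u v)) (ℕ.<⇒≯ v<u ∘ ℕ.<ᵇ⇒< _ _) = refl
... | tri≈ _ u≡v _ rewrite toℕ-injective u≡v | dec-true (v ≟ v) refl
        | dec-false (T? (ascending v v)) (ℕ.n≮n (toℕ v) ∘ ℕ.<ᵇ⇒< _ _) = refl

∑-distinct≡2*∑-ascending : ∀ {n} (b : Fin n → Fin n → Bool) → (∀ u v → b u v ≡ b v u) →
  ∑[ u < n ] ∑[ v < n ] 𝟙 (distinct u v ∧ b u v) ≡ 2 * ∑[ u < n ] ∑[ v < n ] 𝟙 (ascending u v ∧ b u v)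
∑-distinct≡2*∑-ascending {n} b b-sym = begin
  ∑[ u < n ] ∑[ v < n ] 𝟙 (distinct u v ∧ b u v)
    ≡⟨ sum-cong-≗ (λ u → trans (sum-cong-≗ (λ v → 𝟙-distinct-split u v (b u v)))
                               (∑-distrib-+ (up u) (down u))) ⟩
  ∑[ u < n ] (∑[ v < n ] up u v + ∑[ v < n ] down u v)
    ≡⟨ ∑-distrib-+ (sum ∘ up) (sum ∘ down) ⟩
  A + ∑[ u < n ] ∑[ v < n ] down u v
    ≡⟨ cong (A +_) (∑-comm down) ⟩
  A + ∑[ v < n ] ∑[ u < n ] down u v
    ≡⟨ cong (A +_) (sum-cong-≗ (λ v → sum-cong-≗ (λ u → cong (𝟙 ∘ (ascending v u ∧_)) (b-sym u v)))) ⟩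
  A + A
    ≡⟨ cong (A +_) (+-identityʳ A) ⟨
  2 * A ∎
  where
  open ≡-Reasoning
  up down : Fin n → Fin n → ℕ
  up   u v = 𝟙 (ascending u v ∧ b u v)
  down u v = 𝟙 (ascending v u ∧ b u v)
  A : ℕ
  A = ∑[ u < n ] ∑[ v < n ] up u v

Involutive : ∀ {n} → (Fin n → Fin n) → Set
Involutive ψ = ∀ x → ψ (ψ x) ≡ x

∑-involution : ∀ {n} (ψ : Fin n → Fin n) → Involutive ψ →
               (f : Fin n → ℕ) → ∑[ i < n ] f (ψ i) ≡ ∑[ i < n ] f i
∑-involution ψ inv f = sym (sum-permute f (permutation ψ ψ inv inv))

∑∑-involution : ∀ {n} (ψ : Fin n → Fin n) → Involutive ψ → (f : Fin n → Fin n → ℕ) →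
                ∑[ u < n ] ∑[ v < n ] f (ψ u) (ψ v) ≡ ∑[ u < n ] ∑[ v < n ] f u v
∑∑-involution ψ inv f =
  trans (sum-cong-≗ (λ u → ∑-involution ψ inv (f (ψ u)))) (∑-involution ψ inv (λ u → sum (f u)))

∧-reorder : ∀ a b c e → (a ∧ b ∧ c) ∧ e ≡ c ∧ (a ∧ b ∧ e)
∧-reorder true  true  c e = refl
∧-reorder true  false c e = sym (∧-zeroʳ c)
∧-reorder false b     c e = sym (∧-zeroʳ c)

module _ {n} (d : Fin n → Fin n → ℕ) (k : ℕ) where

  pairAtDistance : Subset n → Fin n → Fin n → Bool
  pairAtDistance V u v = does (u ∈? V) ∧ does (v ∈? V) ∧ does (d u v ℕ.≟ k)

  count-distMultiset : ∀ V → count k (distMultiset d V) ≡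
                       ∑[ u < n ] ∑[ v < n ] 𝟙 (ascending u v ∧ pairAtDistance V u v)
  count-distMultiset V =
    trans (count-concatMap k (λ u → concatMap (entry u) (allFin n)) id) (sum-cong-≗ λ u →
    trans (count-concatMap k (entry u) id) (sum-cong-≗ λ v →
    trans (count-if-singleton k _ (d u v))
          (cong 𝟙 (∧-reorder (does (u ∈? V)) (does (v ∈? V)) (ascending u v) _))))
    where
    entry : Fin n → Fin n → List ℕ
    entry u v = if does (u ∈? V) ∧ does (v ∈? V) ∧ ascending u v then d u v ∷ [] else []

  pairAtDistance-sym : (∀ u v → d u v ≡ d v u) →
                       ∀ V u v → pairAtDistance V u v ≡ pairAtDistance V v u
  pairAtDistance-sym d-sym V u v rewrite d-sym u v =
    x∙yz≈y∙xz (CommutativeMonoid.commutativeSemigroup ∧-commutativeMonoid) (does (u ∈? V)) (does (v ∈? V)) _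

  2*count-distMultiset : (∀ u v → d u v ≡ d v u) → ∀ V →
    2 * count k (distMultiset d V) ≡ ∑[ u < n ] ∑[ v < n ] 𝟙 (distinct u v ∧ pairAtDistance V u v)
  2*count-distMultiset d-sym V =
    trans (cong (2 *_) (count-distMultiset V))
          (sym (∑-distinct≡2*∑-ascending (pairAtDistance V) (pairAtDistance-sym d-sym V)))

distMultiset-↭ : ∀ {n} (d : Fin n → Fin n → ℕ) → (∀ u v → d u v ≡ d v u) →
                 {V₁ V₂ : Subset n} (ψ : Fin n → Fin n) → Involutive ψ →
                 (∀ u v → d (ψ u) (ψ v) ≡ d u v) → (∀ u → u ∈ V₁ ⇔ ψ u ∈ V₂) →
                 distMultiset d V₁ ↭ distMultiset d V₂
distMultiset-↭ {n} d d-sym {V₁} {V₂} ψ ψ-inv ψ-d ψ-∈ =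
  count-≗⇒↭ _ _ λ k → *-cancelˡ-≡ _ _ 2 (begin
    2 * count k (distMultiset d V₁)
      ≡⟨ 2*count-distMultiset d k d-sym V₁ ⟩
    ∑[ u < n ] ∑[ v < n ] 𝟙 (distinct u v ∧ pairAtDistance d k V₁ u v)
      ≡⟨ sum-cong-≗ (λ u → sum-cong-≗ (λ v → cong 𝟙 (ψ-pair k u v))) ⟨
    ∑[ u < n ] ∑[ v < n ] 𝟙 (distinct (ψ u) (ψ v) ∧ pairAtDistance d k V₂ (ψ u) (ψ v))
      ≡⟨ ∑∑-involution ψ ψ-inv (λ u v → 𝟙 (distinct u v ∧ pairAtDistance d k V₂ u v)) ⟩
    ∑[ u < n ] ∑[ v < n ] 𝟙 (distinct u v ∧ pairAtDistance d k V₂ u v)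
      ≡⟨ 2*count-distMultiset d k d-sym V₂ ⟨
    2 * count k (distMultiset d V₂) ∎)
  where
  open ≡-Reasoning

  ψ-distinct : ∀ u v → distinct (ψ u) (ψ v) ≡ distinct u v
  ψ-distinct u v = cong not (does-⇔ ψu≡ψv⇔u≡v (ψ u ≟ ψ v) (u ≟ v))
    where
    ψu≡ψv⇔u≡v : ψ u ≡ ψ v ⇔ u ≡ v
    ψu≡ψv⇔u≡v = mk⇔ (λ e → trans (sym (ψ-inv u)) (trans (cong ψ e) (ψ-inv v))) (cong ψ)

  ψ-∈? : ∀ u → does (ψ u ∈? V₂) ≡ does (u ∈? V₁)
  ψ-∈? u = sym (does-⇔ (ψ-∈ u) (u ∈? V₁) (ψ u ∈? V₂))

  ψ-pair : ∀ k u v → distinct (ψ u) (ψ v) ∧ pairAtDistance d k V₂ (ψ u) (ψ v)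
                   ≡ distinct u v ∧ pairAtDistance d k V₁ u v
  ψ-pair k u v rewrite ψ-distinct u v | ψ-∈? u | ψ-∈? v | ψ-d u v = refl

module _ {n} (G : Graph n) where

  Adj-sym : ∀ {u v} → Adj G u v → Adj G v u
  Adj-sym {u} {v} uv = trans (Graph.sym G v u) uv

  Walk-snoc : ∀ {u v w ℓ} → Walk G u v ℓ → Adj G v w → Walk G u w (suc ℓ)
  Walk-snoc here         vw = step vw here
  Walk-snoc (step uw wv) vw = step uw (Walk-snoc wv vw)

  Walk-reverse : ∀ {u v ℓ} → Walk G u v ℓ → Walk G v u ℓ
  Walk-reverse here         = here
  Walk-reverse (step uw wv) = Walk-snoc (Walk-reverse wv) (Adj-sym uw)

  Walk-map : {σ : Fin n → Fin n} → (∀ {x y} → Adj G x y → Adj G (σ x) (σ y)) →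
             ∀ {u v ℓ} → Walk G u v ℓ → Walk G (σ u) (σ v) ℓ
  Walk-map σ-adj here         = here
  Walk-map σ-adj (step uw wv) = step (σ-adj uw) (Walk-map σ-adj wv)

  module _ {dist : Fin n → Fin n → ℕ} (isDist : IsDistFun G dist) where

    dist-minimal : ∀ {u v ℓ} → Walk G u v ℓ → dist u v ≤ ℓ
    dist-minimal walk = proj₂ (isDist _ _) _ walk

    dist-sym : ∀ u v → dist u v ≡ dist v u
    dist-sym u v = ≤-antisym (dist-minimal (Walk-reverse (proj₁ (isDist v u))))
                             (dist-minimal (Walk-reverse (proj₁ (isDist u v))))

    dist-homomorphism-≤ : {σ : Fin n → Fin n} → (∀ {x y} → Adj G x y → Adj G (σ x) (σ y)) →
                          ∀ u v → dist (σ u) (σ v) ≤ dist u v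
    dist-homomorphism-≤ σ-adj u v = dist-minimal (Walk-map σ-adj (proj₁ (isDist u v)))

    dist-involution : {ψ : Fin n → Fin n} → (∀ {x y} → Adj G x y → Adj G (ψ x) (ψ y)) →
                      Involutive ψ → ∀ u v → dist (ψ u) (ψ v) ≡ dist u v
    dist-involution {ψ} ψ-adj ψ-inv u v = ≤-antisym (dist-homomorphism-≤ ψ-adj u v) (begin
      dist u v                 ≡⟨ cong₂ dist (ψ-inv u) (ψ-inv v) ⟨
      dist (ψ (ψ u)) (ψ (ψ v)) ≤⟨ dist-homomorphism-≤ ψ-adj (ψ u) (ψ v) ⟩
      dist (ψ u) (ψ v)         ∎)
      where open ℕ.≤-Reasoning

module DisjointFTwins {n} (G : Graph n) {V₁ V₂ : Subset n}
                      (disjoint : Disjoint V₁ V₂) (twins : FTwins G V₁ V₂) where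

  φ : Fin n → Fin n
  φ = proj₁ twins

  φ-∈ : ∀ {u} → u ∈ V₁ → φ u ∈ V₂
  φ-∈ = proj₁ (proj₁ (proj₂ twins)) _

  φ-injective : ∀ {u v} → u ∈ V₁ → v ∈ V₁ → φ u ≡ φ v → u ≡ v
  φ-injective = proj₁ (proj₂ (proj₁ (proj₂ twins))) _ _

  φ-onto : ∀ w → w ∈ V₂ → ∃ λ u → u ∈ V₁ × φ u ≡ w
  φ-onto = proj₁ (proj₂ (proj₂ (proj₁ (proj₂ twins))))

  φ-adj : ∀ {u v} → u ∈ V₁ → v ∈ V₁ → adj G u v ≡ adj G (φ u) (φ v)
  φ-adj = proj₂ (proj₂ (proj₂ (proj₁ (proj₂ twins)))) _ _

  twin-neighbours : ∀ {u} → u ∈ V₁ → ∀ w → (Adj G u w × w ∉ V₁) ⇔ (Adj G (φ u) w × w ∉ V₂)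
  twin-neighbours = proj₂ (proj₂ twins) _

  no-edge-between : ∀ {x y} → x ∈ V₁ → y ∈ V₂ → ¬ Adj G x y
  no-edge-between {x} {y} x∈V₁ y∈V₂ xy =
    proj₂ (Equivalence.to (twin-neighbours x∈V₁ y) (xy , λ y∈V₁ → disjoint y y∈V₁ y∈V₂)) y∈V₂

  -- Swap x y holds exactly when y = ψ x; matching on it replaces re-running
  -- the case analysis that defines ψ.
  data Swap (x : Fin n) : Fin n → Set where
    left    : x ∈ V₁ → Swap x (φ x)
    right   : ∀ {u} → u ∈ V₁ → φ u ≡ x → Swap x u
    outside : x ∉ V₁ → x ∉ V₂ → Swap x x

  ψ : Fin n → Fin n
  ψ x with x ∈? V₁ | x ∈? V₂
  ... | yes _ | _        = φ x
  ... | no _  | yes x∈V₂ = proj₁ (φ-onto x x∈V₂)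
  ... | no _  | no _     = x

  swap : ∀ x → Swap x (ψ x)
  swap x with x ∈? V₁ | x ∈? V₂
  ... | yes x∈V₁ | _        = left x∈V₁
  ... | no _     | yes x∈V₂ = right (proj₁ (proj₂ (φ-onto x x∈V₂))) (proj₂ (proj₂ (φ-onto x x∈V₂)))
  ... | no x∉V₁  | no x∉V₂  = outside x∉V₁ x∉V₂

  right-∈ : ∀ {u x} → u ∈ V₁ → φ u ≡ x → x ∈ V₂
  right-∈ u∈V₁ refl = φ-∈ u∈V₁

  Swap-sym : ∀ {x y} → Swap x y → Swap y x
  Swap-sym (left x∈V₁)         = right x∈V₁ refl
  Swap-sym (right y∈V₁ refl)   = left y∈V₁
  Swap-sym (outside x∉V₁ x∉V₂) = outside x∉V₁ x∉V₂

  Swap-functional : ∀ {x y z} → Swap x y → Swap x z → y ≡ z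
  Swap-functional (left _)          (left _)          = refl
  Swap-functional (left x∈V₁)       (right u∈V₁ φu≡x) = ⊥-elim (disjoint _ x∈V₁ (right-∈ u∈V₁ φu≡x))
  Swap-functional (left x∈V₁)       (outside x∉V₁ _)  = ⊥-elim (x∉V₁ x∈V₁)
  Swap-functional (right u∈V₁ φu≡x) (left x∈V₁)       = ⊥-elim (disjoint _ x∈V₁ (right-∈ u∈V₁ φu≡x))
  Swap-functional (right u∈V₁ φu≡x) (right v∈V₁ φv≡x) = φ-injective u∈V₁ v∈V₁ (trans φu≡x (sym φv≡x))
  Swap-functional (right u∈V₁ φu≡x) (outside _ x∉V₂)  = ⊥-elim (x∉V₂ (right-∈ u∈V₁ φu≡x))
  Swap-functional (outside x∉V₁ _)  (left x∈V₁)       = ⊥-elim (x∉V₁ x∈V₁)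
  Swap-functional (outside _ x∉V₂)  (right u∈V₁ φu≡x) = ⊥-elim (x∉V₂ (right-∈ u∈V₁ φu≡x))
  Swap-functional (outside _ _)     (outside _ _)     = refl

  ψ-involutive : Involutive ψ
  ψ-involutive x = Swap-functional (swap (ψ x)) (Swap-sym (swap x))

  Swap-∈ : ∀ {x y} → Swap x y → x ∈ V₁ ⇔ y ∈ V₂
  Swap-∈ (left x∈V₁)         = mk⇔ (λ _ → φ-∈ x∈V₁) (λ _ → x∈V₁)
  Swap-∈ (right u∈V₁ φu≡x)   = mk⇔ (λ x∈V₁ → ⊥-elim (disjoint _ x∈V₁ (right-∈ u∈V₁ φu≡x)))
                                   (λ u∈V₂ → ⊥-elim (disjoint _ u∈V₁ u∈V₂))
  Swap-∈ (outside x∉V₁ x∉V₂) = mk⇔ (⊥-elim ∘ x∉V₁) (⊥-elim ∘ x∉V₂)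

  Swap-Adj-outside : ∀ {x x′ y} → Swap x x′ → y ∉ V₁ → y ∉ V₂ → Adj G x y → Adj G x′ y
  Swap-Adj-outside (left x∈V₁) y∉V₁ _ xy =
    proj₁ (Equivalence.to (twin-neighbours x∈V₁ _) (xy , y∉V₁))
  Swap-Adj-outside (right u∈V₁ refl) _ y∉V₂ xy =
    proj₁ (Equivalence.from (twin-neighbours u∈V₁ _) (xy , y∉V₂))
  Swap-Adj-outside (outside _ _) _ _ xy = xy

  Swap-Adj : ∀ {x x′ y y′} → Swap x x′ → Swap y y′ → Adj G x y → Adj G x′ y′
  Swap-Adj (outside x∉V₁ x∉V₂) sy xy = Adj-sym G (Swap-Adj-outside sy x∉V₁ x∉V₂ (Adj-sym G xy))
  Swap-Adj sx (outside y∉V₁ y∉V₂) xy = Swap-Adj-outside sx y∉V₁ y∉V₂ xy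
  Swap-Adj (left x∈V₁) (left y∈V₁) xy = trans (sym (φ-adj x∈V₁ y∈V₁)) xy
  Swap-Adj (left x∈V₁) (right v∈V₁ φv≡y) xy =
    ⊥-elim (no-edge-between x∈V₁ (right-∈ v∈V₁ φv≡y) xy)
  Swap-Adj (right u∈V₁ φu≡x) (left y∈V₁) xy =
    ⊥-elim (no-edge-between y∈V₁ (right-∈ u∈V₁ φu≡x) (Adj-sym G xy))
  Swap-Adj (right u∈V₁ refl) (right v∈V₁ refl) xy = trans (φ-adj u∈V₁ v∈V₁) xy

  ψ-Adj : ∀ {x y} → Adj G x y → Adj G (ψ x) (ψ y)
  ψ-Adj {x} {y} = Swap-Adj (swap x) (swap y)

  ψ-∈ : ∀ u → u ∈ V₁ ⇔ ψ u ∈ V₂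
  ψ-∈ u = Swap-∈ (swap u)

corollary3 : ∀ {n} (G : Graph n) → Connected G →
    (dist : Fin n → Fin n → ℕ) → IsDistFun G dist →
    (V₁ V₂ : Subset n) → Disjoint V₁ V₂ → FTwins G V₁ V₂ →
    distMultiset dist V₁ ↭ distMultiset dist V₂
corollary3 G _ dist isDist V₁ V₂ disjoint twins =
  distMultiset-↭ dist (dist-sym G isDist) ψ ψ-involutive (dist-involution G isDist ψ-Adj ψ-involutive) ψ-∈
  where open DisjointFTwins G disjoint twins
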